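{- Let $\mathsf P$ be an exact amgis-algebra over a termlike $\sigma$-algebra $\mathsf U$, let $X\in\mathrm{Pow}_\sigma(\mathsf P)$, $u,v\in\mathsf U$, and $a$ an atom. For $w,w'\in\mathsf U$ put $(w=^{\mathsf P}w')=\{p\in|\mathsf P|\mid\mathsf N c.\ p[w\Leftarrow c]=p[w'\Leftarrow c]\}$. Then (1) $(u=^{\mathsf P}u)=|\mathsf P|$, and (2) $(u=^{\mathsf P}v)\cap X[a:=u]=(u=^{\mathsf P}v)\cap X[a:=v]$.
   Context: Atoms $\mathbb A$ (countably infinite; $a,b,c$ distinct), permutations, swappings $(a\ b)$, nominal sets, support, $a\#x$, equivariance as standard; $\mathsf N c$ = "for all but finitely many atoms $c$". Termlike $\sigma$-algebra $\mathsf U$: nominal set with equivariant $x[a:=u]$ and equivariant injection $\mathrm{atm}:\mathbb A\to\mathsf U$ satisfying $a[a:=x]=x$; $x[a:=a]=x$; $a\#x\Rightarrow x[a:=u]=x$; $b\#x\Rightarrow x[a:=u]=((b\ a)\cdot x)[b:=u]$; $a\#v\Rightarrow x[a:=u][b:=v]=x[b:=v][a:=u[b:=v]]$. Amgis-algebra over $\mathsf U$: set with permutation action $\mathsf P$ and equivariant $p[u\Leftarrow a]$ with $a\#v\Rightarrow p[v\Leftarrow b][u\Leftarrow a]=p[u[b:=v]\Leftarrow a][v\Leftarrow b]$; exact if $\mathsf N c.\,p[u\Leftarrow c]=q[u\Leftarrow c]$ implies $p=q$. For $X\subseteq|\mathsf P|$: $X[a:=u]=\{p\mid\mathsf N c.\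 p[u\Leftarrow c]\in(c\ a)\cdot X\}$. $\mathrm{Pow}_\sigma(\mathsf P)$: the finitely supported $X\subseteq|\mathsf P|$ with (1) $\forall u\,\mathsf N a\,\forall p\,(p[u\Leftarrow a]\in X\iff p\in X)$ and (2) $\forall a\,\mathsf N b\,\forall p\,(p[b\Leftarrow a]\in X\iff(b\ a)\cdot p\in X)$. -}

module Defs where

open import Data.Nat using (ℕ; _≟_)
open import Data.List using (List; []; _∷_; _++_)
open import Data.List.Membership.Propositional using (_∈_; _∉_)
open import Data.List.Membership.Propositional.Properties using (∈-++⁺ˡ; ∈-++⁺ʳ)
open import Data.List.Relation.Unary.Any using (here; there)
open import Data.Product using (Σ; _×_; _,_)
open import Relation.Binary.PropositionalEquality using (_≡_; _≢_; refl; sym; trans; cong)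
open import Relation.Nullary using (yes; no; ¬_)
open import Data.Empty using (⊥-elim)
open import Data.Unit using (⊤)
open import Function.Bundles using (_⇔_)

Atom : Set
Atom = ℕ

-- "N c. P c": P holds for all but finitely many atoms.
Cofin : (Atom → Set) → Set
Cofin P = Σ (List Atom) λ L → ∀ c → c ∉ L → P c

record Perm : Set where
  field
    fun  : Atom → Atom
    inv  : Atom → Atom
    fun-inv : ∀ x → fun (inv x) ≡ x
    inv-fun : ∀ x → inv (fun x) ≡ x
    dom  : List Atom
    fix  : ∀ x → x ∉ dom → fun x ≡ x
open Perm public

idP : Perm
idP = record { fun = λ x → x ; inv = λ x → x ; fun-inv = λ _ → refl
             ; inv-fun = λ _ → refl ; dom = [] ; fix = λ _ _ → refl }

_∘P_ : Perm → Perm → Perm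
π ∘P ρ = record
  { fun = λ x → fun π (fun ρ x)
  ; inv = λ x → inv ρ (inv π x)
  ; fun-inv = λ x → trans (cong (fun π) (fun-inv ρ (inv π x))) (fun-inv π x)
  ; inv-fun = λ x → trans (cong (inv ρ) (inv-fun π (fun ρ x))) (inv-fun ρ x)
  ; dom = dom π ++ dom ρ
  ; fix = λ x x∉ → trans (cong (fun π) (fix ρ x (λ m → x∉ (∈-++⁺ʳ (dom π) m))))
                         (fix π x (λ m → x∉ (∈-++⁺ˡ m)))
  }

_⁻¹P : Perm → Perm
π ⁻¹P = record
  { fun = inv π ; inv = fun π ; fun-inv = inv-fun π ; inv-fun = fun-inv π
  ; dom = dom π
  ; fix = λ x x∉ → trans (cong (inv π) (sym (fix π x x∉))) (inv-fun π x)
  }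

swapA : Atom → Atom → Atom → Atom
swapA a b c with c ≟ a
... | yes _ = b
... | no _ with c ≟ b
...   | yes _ = a
...   | no _ = c

swapA-a : ∀ a b → swapA a b a ≡ b
swapA-a a b with a ≟ a
... | yes _ = refl
... | no ¬p = ⊥-elim (¬p refl)

swapA-b : ∀ a b → swapA a b b ≡ a
swapA-b a b with b ≟ a
... | yes p = p
... | no _ with b ≟ b
...   | yes _ = refl
...   | no ¬p = ⊥-elim (¬p refl)

swapA-o : ∀ a b c → c ≢ a → c ≢ b → swapA a b c ≡ c
swapA-o a b c ca cb with c ≟ a
... | yes p = ⊥-elim (ca p)
... | no _ with c ≟ b
...   | yes p = ⊥-elim (cb p)
...   | no _ = refl

swapA-inv : ∀ a b c → swapA a b (swapA a b c) ≡ c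
swapA-inv a b c = go (c ≟ a) (c ≟ b)
  where
  open import Relation.Nullary using (Dec)
  go : Dec (c ≡ a) → Dec (c ≡ b) → swapA a b (swapA a b c) ≡ c
  go (yes refl) _ = trans (cong (swapA c b) (swapA-a c b)) (swapA-b c b)
  go (no _) (yes refl) = trans (cong (swapA a c) (swapA-b a c)) (swapA-a a c)
  go (no ca) (no cb) = trans (cong (swapA a b) (swapA-o a b c ca cb)) (swapA-o a b c ca cb)

swp : Atom → Atom → Perm
swp a b = record
  { fun = swapA a b ; inv = swapA a b
  ; fun-inv = swapA-inv a b ; inv-fun = swapA-inv a b
  ; dom = a ∷ b ∷ []
  ; fix = λ c c∉ → swapA-o a b c (λ e → c∉ (here e)) (λ e → c∉ (there (here e)))
  }

record PermSet : Set₁ where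
  field
    Carrier : Set
    act     : Perm → Carrier → Carrier
    act-id  : ∀ x → act idP x ≡ x
    act-∘   : ∀ π ρ x → act (π ∘P ρ) x ≡ act π (act ρ x)
    act-ext : ∀ π ρ → (∀ a → fun π a ≡ fun ρ a) → ∀ x → act π x ≡ act ρ x

module _ (S : PermSet) where
  open PermSet S

  Supports : List Atom → Carrier → Set
  Supports A x = ∀ π → (∀ a → a ∈ A → fun π a ≡ a) → act π x ≡ x

  FinSupp : Carrier → Set
  FinSupp x = Σ (List Atom) λ A → Supports A x

  -- a # x : a lies outside some (equivalently, the least) finite support of x
  Fresh : Atom → Carrier → Set
  Fresh a x = Σ (List Atom) λ A → Supports A x × a ∉ A

  Subset : Set₁
  Subset = Carrier → Set

  actSub : Perm → Subset → Subset
  actSub π X p = X (act (π ⁻¹P) p)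

  SupportsSub : List Atom → Subset → Set
  SupportsSub A X = ∀ π → (∀ a → a ∈ A → fun π a ≡ a) → ∀ p → actSub π X p ⇔ X p

  FinSuppSub : Subset → Set
  FinSuppSub X = Σ (List Atom) λ A → SupportsSub A X

  _≐_ : Subset → Subset → Set
  X ≐ Y = ∀ p → X p ⇔ Y p

  _∩_ : Subset → Subset → Subset
  (X ∩ Y) p = X p × Y p

  Full : Subset
  Full _ = ⊤

record NominalSet : Set₁ where
  field
    perm    : PermSet
  open PermSet perm public
  field
    finSupp : ∀ x → FinSupp perm x

-- Termlike σ-algebras.  x [ a := u ] is written sub x a u.

record TermlikeSigma (U : NominalSet) : Set where
  open NominalSet U
  field
    sub     : Carrier → Atom → Carrier → Carrier
    atm     : Atom → Carrier
    sub-eqv : ∀ π x a u → act π (sub x a u) ≡ sub (act π x) (fun π a) (act π u)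
    atm-eqv : ∀ π a → act π (atm a) ≡ atm (fun π a)
    atm-inj : ∀ a b → atm a ≡ atm b → a ≡ b
    σvar    : ∀ a x → sub (atm a) a x ≡ x
    σid     : ∀ a x → sub x a (atm a) ≡ x
    σ#      : ∀ a x u → Fresh perm a x → sub x a u ≡ x
    σα      : ∀ a b x u → a ≢ b → Fresh perm b x → sub x a u ≡ sub (act (swp b a) x) b u
    σσ      : ∀ a b x u v → a ≢ b → Fresh perm a v →
              sub (sub x a u) b v ≡ sub (sub x b v) a (sub u b v)

-- Amgis-algebras over U.  p [ u ⇐ a ] is written amg p u a.

record Amgis (U : NominalSet) (T : TermlikeSigma U) (P : PermSet) : Set where
  private module U = NominalSet U
  private module P = PermSet P
  open TermlikeSigma T
  field
    amg     : P.Carrier → U.Carrier → Atom → P.Carrier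
    amg-eqv : ∀ π p u a → P.act π (amg p u a) ≡ amg (P.act π p) (U.act π u) (fun π a)
    amg-ax  : ∀ a b p u v → a ≢ b → Fresh U.perm a v →
              amg (amg p v b) u a ≡ amg (amg p (sub u b v) a) v b

module _ {U : NominalSet} {T : TermlikeSigma U} {P : PermSet} (A : Amgis U T P) where
  private module U = NominalSet U
  open PermSet P
  open TermlikeSigma T
  open Amgis A

  Exact : Set
  Exact = ∀ p q u → Cofin (λ c → amg p u c ≡ amg q u c) → p ≡ q

  subSet : Subset P → Atom → U.Carrier → Subset P
  subSet X a u p = Cofin λ c → actSub P (swp c a) X (amg p u c)

  PowSigma : Subset P → Set
  PowSigma X = FinSuppSub P X
             × (∀ u → Cofin λ a → ∀ p → X (amg p u a) ⇔ X p)
             × (∀ a → Cofin λ b → ∀ p → X (amg p (atm b) a) ⇔ X (act (swp b a) p))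

  EqSet : U.Carrier → U.Carrier → Subset P
  EqSet w w' p = Cofin λ c → amg p w c ≡ amg p w' c

-- Both parts hold pointwise in the bound atom c: for cofinitely many c we
-- have p[u⇐c] = p[v⇐c], so membership of p[u⇐c] in (c a)·X transfers to
-- p[v⇐c]; intersecting the two cofinite sets of atoms keeps it cofinite.
module Submission where

open import Defs
open import Data.List using ([]; _++_)
open import Data.List.Membership.Propositional.Properties using (∈-++⁺ˡ; ∈-++⁺ʳ)
open import Data.Product using (_×_; _,_)
open import Data.Unit using (tt)
open import Function.Bundles using (mk⇔)
open import Relation.Binary.PropositionalEquality using (refl; sym; subst)

cofin-all : ∀ {P : Atom → Set} → (∀ c → P c) → Cofin P
cofin-all p = [] , λ c _ → p c

cofin-zipWith : ∀ {P Q R : Atom → Set} → (∀ {c} → P c → Q c → R c) →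
                Cofin P → Cofin Q → Cofin R
cofin-zipWith f (L , p) (M , q) =
  L ++ M , λ c c∉ → f (p c (λ c∈L → c∉ (∈-++⁺ˡ c∈L))) (q c (λ c∈M → c∉ (∈-++⁺ʳ L c∈M)))

module _ {U : NominalSet} {T : TermlikeSigma U} {P : PermSet} (A : Amgis U T P) where

  EqSet-refl : ∀ u → _≐_ P (EqSet A u u) (Full P)
  EqSet-refl u p = mk⇔ (λ _ → tt) (λ _ → cofin-all λ _ → refl)

  EqSet-sym : ∀ {u v p} → EqSet A u v p → EqSet A v u p
  EqSet-sym (L , e) = L , λ c c∉ → sym (e c c∉)

  subSet-transport : ∀ (X : Subset P) a {u v p} →
                     EqSet A u v p → subSet A X a u p → subSet A X a v p
  subSet-transport X a = cofin-zipWith λ {c} e → subst (actSub P (swp c a) X) e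

  EqSet-∩-subSet : ∀ (X : Subset P) a u v →
                   _≐_ P (_∩_ P (EqSet A u v) (subSet A X a u))
                         (_∩_ P (EqSet A u v) (subSet A X a v))
  EqSet-∩-subSet X a u v p = mk⇔
    (λ (e , x) → e , subSet-transport X a e x)
    (λ (e , x) → e , subSet-transport X a (EqSet-sym e) x)

proposition6p18 : (U : NominalSet) (T : TermlikeSigma U) (P : PermSet) (A : Amgis U T P) →
    Exact A → (X : Subset P) → PowSigma A X →
    (u v : NominalSet.Carrier U) (a : Atom) →
    _≐_ P (EqSet A u u) (Full P)
    × _≐_ P (_∩_ P (EqSet A u v) (subSet A X a u)) (_∩_ P (EqSet A u v) (subSet A X a v))
proposition6p18 U T P A _ X _ u v a = EqSet-refl A u , EqSet-∩-subSet A X a u v
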